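{- Let $k<n$ and let $A_1,\dots,A_k$ be $n\times n$ alternating sign matrices, $A_s=[a_{ijs}]_{i,j}$, such that for all $1\le i,j\le n$ the vector $(a_{ij1},\dots,a_{ijk})$ is $(1,*)$-alternating. Then there exist $n\times n$ ASMs $A_{k+1},\dots,A_n$ such that $[A_1,\dots,A_k,A_{k+1},\dots,A_n]$ is an $n\times n\times n$ alternating sign hypermatrix. Moreover, each of $A_{k+1},\dots,A_n$ may be chosen to be a permutation matrix.
   Context: An $n\times n$ alternating sign matrix (ASM) is a $(0,\pm1)$-matrix whose rows and columns each have nonzeros alternating in sign beginning and ending with $+1$. An $n\times n\times n$ hypermatrix $[A_1,\dots,A_n]$ with horizontal planes $A_s=[a_{ijs}]$ is an alternating sign hypermatrix (ASHM) if every line (fix two of the indices, vary the third) has nonzeros alternating in sign beginning and ending with $+1$. A $(0,\pm1)$-vector is $(1,*)$-alternating if its nonzeros (if any) alternate in sign and the first nonzero is $1$. -}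

module Defs where

open import Data.Nat using (ℕ; _<_)
open import Data.Fin using (Fin; toℕ)
open import Data.Fin.Permutation using (Permutation′; _⟨$⟩ʳ_)
open import Data.List using (List; []; _∷_; tabulate)
open import Relation.Binary.PropositionalEquality using (_≡_)
open import Relation.Nullary using (¬_)

data Sign : Set where
  zer pos neg : Sign

nonzeros : List Sign → List Sign
nonzeros []          = []
nonzeros (zer ∷ xs)  = nonzeros xs
nonzeros (pos ∷ xs)  = pos ∷ nonzeros xs
nonzeros (neg ∷ xs)  = neg ∷ nonzeros xs

data AltFromPos : List Sign → Set
data AltFromNeg : List Sign → Set
data AltFromPos where
  ap-nil  : AltFromPos []
  ap-cons : ∀ {xs} → AltFromNeg xs → AltFromPos (pos ∷ xs)
data AltFromNeg where
  an-nil  : AltFromNeg []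
  an-cons : ∀ {xs} → AltFromPos xs → AltFromNeg (neg ∷ xs)

data PosAltPos : List Sign → Set where
  single : PosAltPos (pos ∷ [])
  step   : ∀ {xs} → PosAltPos xs → PosAltPos (pos ∷ neg ∷ xs)

OneStarAlt : List Sign → Set
OneStarAlt v = AltFromPos (nonzeros v)

AltSign : List Sign → Set
AltSign v = PosAltPos (nonzeros v)

vec : ∀ {n} → (Fin n → Sign) → List Sign
vec f = tabulate f

Matrix : ℕ → Set
Matrix n = Fin n → Fin n → Sign

IsASM : ∀ {n} → Matrix n → Set
IsASM {n} M = (∀ (i : Fin n) → AltSign (vec (λ j → M i j)))
            × (∀ (j : Fin n) → AltSign (vec (λ i → M i j)))
  where open import Data.Product using (_×_)

IsPermMatrix : ∀ {n} → Matrix n → Set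
IsPermMatrix {n} M = Σ (Permutation′ n) λ σ →
  ∀ i j → ((σ ⟨$⟩ʳ i ≡ j → M i j ≡ pos) × (¬ (σ ⟨$⟩ʳ i ≡ j) → M i j ≡ zer))
  where open import Data.Product using (Σ; _×_)

-- n×n×n hypermatrix with entries H i j s = a_{ijs}; A_s = plane s
Hyper : ℕ → Set
Hyper n = Fin n → Fin n → Fin n → Sign

IsASHM : ∀ {n} → Hyper n → Set
IsASHM {n} H = (∀ (j s : Fin n) → AltSign (vec (λ i → H i j s)))
             × (∀ (i s : Fin n) → AltSign (vec (λ j → H i j s)))
             × (∀ (i j : Fin n) → AltSign (vec (λ s → H i j s)))
  where open import Data.Product using (_×_)

module Submission where

-- A (1,*)-alternating line becomes alternating sign by appending one +1 exactly when
-- its number of nonzeros is even (`needsOne`, `complete`); otherwise it already is.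
-- Let D be the 0/1 matrix of the lines needing a +1.  Double counting (`needsOne-count`):
-- in each row of the stack the k planes carry k more +1's than −1's, while a line
-- carries one extra +1 iff it needs none; so every row and column of D has n − k ones.

open import Defs
open import Data.Bool using (Bool; true; false; T; not; _∧_; _∨_; if_then_else_)
open import Data.Bool.Properties using (T?; ∧-identityʳ)
open import Data.Empty using (⊥-elim)
open import Data.Fin using (Fin; zero; suc; punchOut; toℕ; inject≤; splitAt; reduce≥; _↑ˡ_)
open import Data.Fin.Permutation
  using (Permutation′; _⟨$⟩ʳ_; _⟨$⟩ˡ_; permutation; inverseˡ; inverseʳ)
open import Data.Fin.Properties
  using ( _≟_; all?; any?; punchOut-injective; injective⇒≤; toℕ-injective; toℕ-inject≤
        ; toℕ-↑ˡ; splitAt-↑ˡ; splitAt-≥)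
open import Data.Fin.Subset.Properties using (anySubset?)
open import Data.List using (List; []; _∷_; _++_; length; replicate)
import Data.List as List
open import Data.Nat using (ℕ; zero; suc; _+_; _*_; _≤_; _<_; _≤?_; z≤n; s≤s)
open import Data.Nat.Induction using (<-wellFounded)
open import Data.Nat.Properties
  using ( +-*-semiring; ≤-refl; ≤-trans; <-irrefl; n<1+n; 1+n≰n; ≰⇒>; n≤0⇒n≡0; <⇒≤
        ; m≤m+n; m≤n+m; +-comm; +-identityʳ; +-mono-≤; +-monoʳ-≤; +-cancelˡ-≡
        ; +-cancelʳ-≤; *-cancelʳ-≤; suc-injective; m≤n⇒∃[o]m+o≡n; module ≤-Reasoning)
open import Data.Product using (Σ; ∃; _×_; _,_; proj₁; proj₂)
open import Data.Sum using (_⊎_; inj₁; inj₂; [_,_]; [_,_]′; map₁)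
open import Data.Vec using (lookup; tabulate)
open import Data.Vec.Properties using (lookup∘tabulate)
open import Function using (_∘_; id)
open import Function.Bundles using (mk⇔)
open import Induction.WellFounded using (Acc; acc)
open import Relation.Binary.PropositionalEquality
  using (_≡_; _≢_; refl; sym; trans; cong; cong₂; subst; subst₂; module ≡-Reasoning)
open import Relation.Nullary using (¬_; Dec; does; yes; no; ¬?)
open import Relation.Nullary.Decidable
  using (map′; _×-dec_; _→-dec_; does-⇔; dec-true; dec-false)
open import Algebra.Properties.Semiring.Sum +-*-semiring
  using (sum; sum-syntax; ∑-comm; ∑-distrib-+; sum-cong-≗; *-distribʳ-sum)

private variable
  n : ℕ

𝟙 : Bool → ℕ
𝟙 true  = 1
𝟙 false = 0

∑-mono : ∀ {f g : Fin n → ℕ} → (∀ i → f i ≤ g i) → ∑[ i < n ] f i ≤ ∑[ i < n ] g i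
∑-mono {zero}  f≤g = z≤n
∑-mono {suc n} f≤g = +-mono-≤ (f≤g zero) (∑-mono (f≤g ∘ suc))

∑-one : ∀ n → ∑[ i < n ] 1 ≡ n
∑-one zero    = refl
∑-one (suc n) = cong suc (∑-one n)

∑-zero : ∀ n → ∑[ i < n ] 0 ≡ 0
∑-zero zero    = refl
∑-zero (suc n) = ∑-zero n

T-∧⁻ : ∀ a {b} → T (a ∧ b) → T a × T b
T-∧⁻ true b = _ , b

T-∧⁺ : ∀ {a b} → T a → T b → T (a ∧ b)
T-∧⁺ {true} _ b = b

𝟙-mono : ∀ a b → (T a → T b) → 𝟙 a ≤ 𝟙 b
𝟙-mono false b     _   = z≤n
𝟙-mono true  true  _   = ≤-refl
𝟙-mono true  false a⇒b = ⊥-elim (a⇒b _)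

𝟙-∨-≤ : ∀ a b c → (T a → T (b ∨ c)) → 𝟙 a ≤ 𝟙 b + 𝟙 c
𝟙-∨-≤ false b     c     _ = z≤n
𝟙-∨-≤ true  true  c     _ = s≤s z≤n
𝟙-∨-≤ true  false true  _ = ≤-refl
𝟙-∨-≤ true  false false h = ⊥-elim (h _)

𝟙-∨-disjoint : ∀ a b → (T a → ¬ T b) → 𝟙 (a ∨ b) ≡ 𝟙 a + 𝟙 b
𝟙-∨-disjoint true  true  h = ⊥-elim (h _ _)
𝟙-∨-disjoint true  false _ = refl
𝟙-∨-disjoint false b     _ = refl

𝟙-not : ∀ a → 𝟙 a + 𝟙 (not a) ≡ 1
𝟙-not true  = refl
𝟙-not false = refl

𝟙-split : ∀ a b → (T a → T b) → 𝟙 a + 𝟙 (b ∧ not a) ≡ 𝟙 b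
𝟙-split true  true  _   = refl
𝟙-split true  false a⇒b = ⊥-elim (a⇒b _)
𝟙-split false true  _   = refl
𝟙-split false false _   = refl

∨-absorb : ∀ a b → (T a → T b) → b ≡ a ∨ (b ∧ not a)
∨-absorb true  true  _   = refl
∨-absorb true  false a⇒b = ⊥-elim (a⇒b _)
∨-absorb false b     _   = sym (∧-identityʳ b)

FinSet : ℕ → Set
FinSet n = Fin n → Bool

infix 4 _∈_ _∉_ _⊆_
infixr 6 _∪_
infixl 5 _─_

_∈_ : Fin n → FinSet n → Set
i ∈ S = T (S i)

_∉_ : Fin n → FinSet n → Set
i ∉ S = ¬ (i ∈ S)

_⊆_ : FinSet n → FinSet n → Set
S ⊆ R = ∀ {i} → i ∈ S → i ∈ R

_∪_ : FinSet n → FinSet n → FinSet n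
(S ∪ R) i = S i ∨ R i

_─_ : FinSet n → FinSet n → FinSet n
(S ─ R) i = S i ∧ not (R i)

⁅_⁆ : Fin n → FinSet n
⁅ x ⁆ y = does (x ≟ y)

∣_∣ : FinSet n → ℕ
∣ S ∣ = sum (𝟙 ∘ S)

∈∪⁻ : ∀ (S R : FinSet n) {i} → i ∈ S ∪ R → i ∈ S ⊎ i ∈ R
∈∪⁻ S R {i} i∈ with S i
... | true  = inj₁ _
... | false = inj₂ i∈

∈∪⁺ˡ : ∀ {S : FinSet n} R {i} → i ∈ S → i ∈ S ∪ R
∈∪⁺ˡ {S = S} R {i} i∈S with S i
... | true = _

∈∪⁺ʳ : ∀ (S : FinSet n) {R i} → i ∈ R → i ∈ S ∪ R
∈∪⁺ʳ S {i = i} i∈R with S i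
... | true  = _
... | false = i∈R

∈─⁻ : ∀ (S R : FinSet n) {i} → i ∈ S ─ R → i ∈ S × i ∉ R
∈─⁻ S R {i} i∈ with S i | R i
... | true | false = _ , λ ()

∈─⁺ : ∀ {S R : FinSet n} {i} → i ∈ S → i ∉ R → i ∈ S ─ R
∈─⁺ {S = S} {R} {i} i∈S i∉R with S i | R i
... | true | true  = i∉R _
... | true | false = _

∈⁅⁆⁻ : ∀ {x y : Fin n} → y ∈ ⁅ x ⁆ → x ≡ y
∈⁅⁆⁻ {x = x} {y} y∈⁅x⁆ with x ≟ y
... | yes x≡y = x≡y

∈⁅⁆⁺ : ∀ {x y : Fin n} → x ≡ y → y ∈ ⁅ x ⁆
∈⁅⁆⁺ {x = x} {y} x≡y with x ≟ y
... | yes _   = _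
... | no  x≢y = x≢y x≡y

∣∣-cong : ∀ {S R : FinSet n} → (∀ i → S i ≡ R i) → ∣ S ∣ ≡ ∣ R ∣
∣∣-cong S≗R = sum-cong-≗ (cong 𝟙 ∘ S≗R)

∣∣-mono : ∀ {S R : FinSet n} → S ⊆ R → ∣ S ∣ ≤ ∣ R ∣
∣∣-mono {S = S} {R} S⊆R = ∑-mono λ i → 𝟙-mono (S i) (R i) S⊆R

𝟙≤∣∣ : ∀ (S : FinSet n) i → 𝟙 (S i) ≤ ∣ S ∣
𝟙≤∣∣ S zero    = m≤m+n (𝟙 (S zero)) _
𝟙≤∣∣ S (suc i) = ≤-trans (𝟙≤∣∣ (S ∘ suc) i) (m≤n+m _ (𝟙 (S zero)))

∣∣-⊆∪ : ∀ {S R U : FinSet n} → S ⊆ R ∪ U → ∣ S ∣ ≤ ∣ R ∣ + ∣ U ∣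
∣∣-⊆∪ {S = S} {R} {U} S⊆R∪U = begin
  ∣ S ∣                            ≤⟨ ∑-mono (λ i → 𝟙-∨-≤ (S i) (R i) (U i) S⊆R∪U) ⟩
  ∑[ i < _ ] (𝟙 (R i) + 𝟙 (U i))  ≡⟨ ∑-distrib-+ (𝟙 ∘ R) (𝟙 ∘ U) ⟩
  ∣ R ∣ + ∣ U ∣                    ∎
  where open ≤-Reasoning

∣∣-∪-disjoint : ∀ {S R : FinSet n} → (∀ {i} → i ∈ S → i ∉ R) → ∣ S ∪ R ∣ ≡ ∣ S ∣ + ∣ R ∣
∣∣-∪-disjoint {S = S} {R} disjoint =
  trans (sum-cong-≗ λ i → 𝟙-∨-disjoint (S i) (R i) disjoint) (∑-distrib-+ (𝟙 ∘ S) (𝟙 ∘ R))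

∣∣-complement : ∀ (S : FinSet n) → ∣ S ∣ + ∣ not ∘ S ∣ ≡ n
∣∣-complement {n} S =
  trans (sym (∑-distrib-+ (𝟙 ∘ S) (𝟙 ∘ not ∘ S))) (trans (sum-cong-≗ (𝟙-not ∘ S)) (∑-one n))

∣⁅⁆∣ : ∀ (x : Fin n) → ∣ ⁅ x ⁆ ∣ ≡ 1
∣⁅⁆∣ {suc n} zero    = cong suc (∑-zero n)
∣⁅⁆∣ {suc n} (suc x) = ∣⁅⁆∣ x

∣∣-remove : ∀ {S : FinSet n} {x} → x ∈ S → ∣ S ∣ ≡ suc ∣ S ─ ⁅ x ⁆ ∣
∣∣-remove {S = S} {x} x∈S = begin
  ∣ S ∣                     ≡⟨ ∣∣-cong (λ y → ∨-absorb (⁅ x ⁆ y) (S y) ⁅x⁆⊆S) ⟩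
  ∣ ⁅ x ⁆ ∪ (S ─ ⁅ x ⁆) ∣   ≡⟨ ∣∣-∪-disjoint {S = ⁅ x ⁆} (λ y∈⁅x⁆ y∈S─x → proj₂ (∈─⁻ S ⁅ x ⁆ y∈S─x) y∈⁅x⁆) ⟩
  ∣ ⁅ x ⁆ ∣ + ∣ S ─ ⁅ x ⁆ ∣ ≡⟨ cong (_+ ∣ S ─ ⁅ x ⁆ ∣) (∣⁅⁆∣ x) ⟩
  suc ∣ S ─ ⁅ x ⁆ ∣         ∎
  where
  open ≡-Reasoning
  ⁅x⁆⊆S : ⁅ x ⁆ ⊆ S
  ⁅x⁆⊆S y∈⁅x⁆ = subst (_∈ S) (∈⁅⁆⁻ y∈⁅x⁆) x∈S

∣∣-pos : ∀ {S : FinSet n} {x} → x ∈ S → 0 < ∣ S ∣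
∣∣-pos {S = S} x∈S = subst (0 <_) (sym (∣∣-remove {S = S} x∈S)) (s≤s z≤n)

∣∣-witness : ∀ {S : FinSet n} → 0 < ∣ S ∣ → ∃ λ x → x ∈ S
∣∣-witness {suc n} {S} 0<∣S∣ with S zero in eq
... | true  = zero , subst T (sym eq) _
... | false = let x , x∈S = ∣∣-witness {S = S ∘ suc} 0<∣S∣ in suc x , x∈S

∣∣-empty-or-witness : ∀ (S : FinSet n) → ∣ S ∣ ≡ 0 ⊎ ∃ λ x → x ∈ S
∣∣-empty-or-witness S with ∣ S ∣ in eq
... | zero  = inj₁ refl
... | suc _ = inj₂ (∣∣-witness {S = S} (subst (0 <_) (sym eq) (s≤s z≤n)))

∣∣-strict : ∀ {S R : FinSet n} {y} → S ⊆ R → y ∈ R → y ∉ S → ∣ S ∣ < ∣ R ∣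
∣∣-strict {S = S} {R} {y} S⊆R y∈R y∉S = begin-strict
  ∣ S ∣             <⟨ n<1+n ∣ S ∣ ⟩
  suc ∣ S ∣         ≡⟨ cong (_+ ∣ S ∣) (∣⁅⁆∣ y) ⟨
  ∣ ⁅ y ⁆ ∣ + ∣ S ∣ ≡⟨ ∣∣-∪-disjoint {S = ⁅ y ⁆} (λ y′∈⁅y⁆ → y∉S ∘ subst (_∈ S) (sym (∈⁅⁆⁻ y′∈⁅y⁆)))
                    ⟨
  ∣ ⁅ y ⁆ ∪ S ∣     ≤⟨ ∣∣-mono {S = ⁅ y ⁆ ∪ S} ⁅y⁆∪S⊆R ⟩
  ∣ R ∣             ∎
  where
  open ≤-Reasoning
  ⁅y⁆∪S⊆R : ⁅ y ⁆ ∪ S ⊆ R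
  ⁅y⁆∪S⊆R {i} i∈ with ∈∪⁻ ⁅ y ⁆ S i∈
  ... | inj₁ i∈⁅y⁆ = subst (_∈ R) (∈⁅⁆⁻ i∈⁅y⁆) y∈R
  ... | inj₂ i∈S   = S⊆R i∈S

∣─∣< : ∀ {R S : FinSet n} {x} → x ∈ R → x ∈ S → ∣ R ─ S ∣ < ∣ R ∣
∣─∣< {R = R} {S} x∈R x∈S =
  ∣∣-strict {S = R ─ S} {R} (proj₁ ∘ ∈─⁻ R S) x∈R (λ x∈R─S → proj₂ (∈─⁻ R S x∈R─S) x∈S)

∃ᵇ : (Fin n → Bool) → Bool
∃ᵇ {zero}  p = false
∃ᵇ {suc n} p = p zero ∨ ∃ᵇ (p ∘ suc)

∃ᵇ-intro : ∀ (p : Fin n → Bool) i → T (p i) → T (∃ᵇ p)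
∃ᵇ-intro p zero    pi with p zero
... | true  = _
∃ᵇ-intro p (suc i) pi with p zero
... | true  = _
... | false = ∃ᵇ-intro (p ∘ suc) i pi

∃ᵇ-elim : ∀ (p : Fin n → Bool) → T (∃ᵇ p) → ∃ λ i → T (p i)
∃ᵇ-elim {suc n} p h with p zero in eq
... | true  = zero , subst T (sym eq) _
... | false = let i , pi = ∃ᵇ-elim (p ∘ suc) h in suc i , pi

∃ᵇ-cong : ∀ {p q : Fin n → Bool} → (∀ i → p i ≡ q i) → ∃ᵇ p ≡ ∃ᵇ q
∃ᵇ-cong {zero}  p≗q = refl
∃ᵇ-cong {suc n} p≗q = cong₂ _∨_ (p≗q zero) (∃ᵇ-cong (p≗q ∘ suc))

-- Hall's marriage theorem for a bipartite graph D on Fin n × Fin n (j ∈ D i means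
-- that i and j are adjacent), restricted to left vertices R and right vertices K.
-- The proof is the classical induction on ∣ R ∣: if some nonempty proper S ⊂ R is
-- tight (∣ N S ∣ ≤ ∣ S ∣), match S into N S and R ─ S into K ─ N S separately;
-- otherwise match any r ∈ R to any neighbour c, and R ─ ⁅ r ⁆ into K ─ ⁅ c ⁆.
module Hall {n} (D : Fin n → FinSet n) where

  N : FinSet n → FinSet n → FinSet n
  N K S j = K j ∧ ∃ᵇ (λ i → S i ∧ D i j)

  N-intro : ∀ {K S i j} → i ∈ S → j ∈ D i → j ∈ K → j ∈ N K S
  N-intro {S = S} {i} {j} i∈S j∈Di j∈K =
    T-∧⁺ j∈K (∃ᵇ-intro (λ i → S i ∧ D i j) i (T-∧⁺ i∈S j∈Di))

  N-elim : ∀ {K S j} → j ∈ N K S → j ∈ K × ∃ λ i → i ∈ S × j ∈ D i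
  N-elim {K} {S} {j} j∈N =
    let j∈K , ∃i = T-∧⁻ (K j) j∈N
        i , i∈S∧j∈Di = ∃ᵇ-elim (λ i → S i ∧ D i j) ∃i
    in j∈K , i , T-∧⁻ (S i) i∈S∧j∈Di

  N-cong : ∀ K {S S′} → (∀ i → S i ≡ S′ i) → ∀ j → N K S j ≡ N K S′ j
  N-cong K S≗S′ j = cong (K j ∧_) (∃ᵇ-cong (λ i → cong (_∧ D i j) (S≗S′ i)))

  HallCondition : FinSet n → FinSet n → Set
  HallCondition R K = ∀ S → S ⊆ R → ∣ S ∣ ≤ ∣ N K S ∣

  record Matching (R K : FinSet n) (f : Fin n → Fin n) : Set where
    field
      into      : ∀ {i} → i ∈ R → f i ∈ K
      along     : ∀ {i} → i ∈ R → f i ∈ D i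
      injective : ∀ {i i′} → i ∈ R → i′ ∈ R → f i ≡ f i′ → i ≡ i′

  open Matching

  empty-matching : ∀ {R K f} → (∀ {i} → i ∉ R) → Matching R K f
  empty-matching R-empty = record
    { into      = ⊥-elim ∘ R-empty
    ; along     = ⊥-elim ∘ R-empty
    ; injective = λ i∈R _ _ → ⊥-elim (R-empty i∈R)
    }

  singleton-matching : ∀ {K r c} → c ∈ K → c ∈ D r → Matching ⁅ r ⁆ K (λ _ → c)
  singleton-matching {r = r} {c} c∈K c∈Dr = record
    { into      = λ _ → c∈K
    ; along     = λ i∈⁅r⁆ → subst (λ i → c ∈ D i) (∈⁅⁆⁻ i∈⁅r⁆) c∈Dr
    ; injective = λ i∈⁅r⁆ i′∈⁅r⁆ _ → trans (sym (∈⁅⁆⁻ {x = r} i∈⁅r⁆)) (∈⁅⁆⁻ i′∈⁅r⁆)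
    }

  matching-weaken : ∀ {R K K′ f} → K′ ⊆ K → Matching R K′ f → Matching R K f
  matching-weaken K′⊆K m = record
    { into = K′⊆K ∘ into m ; along = along m ; injective = injective m }

  choose : FinSet n → (Fin n → Fin n) → (Fin n → Fin n) → Fin n → Fin n
  choose S f g i = if S i then f i else g i

  choose-cases : ∀ R S f g {i} → i ∈ R →
    (i ∈ S × choose S f g i ≡ f i) ⊎ (i ∈ R ─ S × choose S f g i ≡ g i)
  choose-cases R S f g {i} i∈R with S i
  ... | true  = inj₁ (_ , refl)
  ... | false = inj₂ (subst T (sym (∧-identityʳ (R i))) i∈R , refl)

  glue : ∀ {R K S f g} → Matching S K f → Matching (R ─ S) K g
    → (∀ {i i′} → i ∈ S → i′ ∈ R ─ S → f i ≢ g i′)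
    → Matching R K (choose S f g)
  glue {R} {K} {S} {f} {g} mf mg apart = record
    { into      = λ i∈R → pointwise (λ _ j → j ∈ K) (into mf) (into mg) i∈R
    ; along     = λ i∈R → pointwise (λ i j → j ∈ D i) (along mf) (along mg) i∈R
    ; injective = inj
    }
    where
    pointwise : ∀ (P : Fin n → Fin n → Set)
      → (∀ {i} → i ∈ S → P i (f i)) → (∀ {i} → i ∈ R ─ S → P i (g i))
      → ∀ {i} → i ∈ R → P i (choose S f g i)
    pointwise P Pf Pg {i} i∈R with choose-cases R S f g i∈R
    ... | inj₁ (i∈S   , eq) = subst (P i) (sym eq) (Pf i∈S)
    ... | inj₂ (i∈R─S , eq) = subst (P i) (sym eq) (Pg i∈R─S)

    inj : ∀ {i i′} → i ∈ R → i′ ∈ R → choose S f g i ≡ choose S f g i′ → i ≡ i′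
    inj i∈R i′∈R same with choose-cases R S f g i∈R | choose-cases R S f g i′∈R
    ... | inj₁ (a , e) | inj₁ (a′ , e′) = injective mf a a′ (trans (sym e) (trans same e′))
    ... | inj₂ (b , e) | inj₂ (b′ , e′) = injective mg b b′ (trans (sym e) (trans same e′))
    ... | inj₁ (a , e) | inj₂ (b′ , e′) = ⊥-elim (apart a b′ (trans (sym e) (trans same e′)))
    ... | inj₂ (b , e) | inj₁ (a′ , e′) = ⊥-elim (apart a′ b (trans (sym e′) (trans (sym same) e)))

  apart-by : ∀ {S R′ X : FinSet n} {f g : Fin n → Fin n}
    → (∀ {i} → i ∈ S → f i ∈ X) → (∀ {i} → i ∈ R′ → g i ∉ X)
    → ∀ {i i′} → i ∈ S → i′ ∈ R′ → f i ≢ g i′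
  apart-by {X = X} fX gX i∈S i′∈R′ fi≡gi′ = gX i′∈R′ (subst (_∈ X) fi≡gi′ (fX i∈S))

  restrict : ∀ {R K S} → HallCondition R K → S ⊆ R → HallCondition S K
  restrict hallR S⊆R T T⊆S = hallR T (S⊆R ∘ T⊆S)

  N-split : ∀ K S T → N K (T ∪ S) ⊆ N (K ─ N K S) T ∪ N K S
  N-split K S T {j} j∈N with T? (N K S j)
  ... | yes j∈NS = ∈∪⁺ʳ (N (K ─ N K S) T) {N K S} j∈NS
  ... | no  j∉NS with N-elim {K} {T ∪ S} j∈N
  ...   | j∈K , i , i∈T∪S , j∈Di with ∈∪⁻ T S i∈T∪S
  ...     | inj₁ i∈T = ∈∪⁺ˡ {S = N (K ─ N K S) T} (N K S)
                           (N-intro {K ─ N K S} {T} i∈T j∈Di (∈─⁺ {S = K} {N K S} j∈K j∉NS))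
  ...     | inj₂ i∈S = ⊥-elim (j∉NS (N-intro {K} {S} i∈S j∈Di j∈K))

  hall-complement : ∀ {R K S} → HallCondition R K → S ⊆ R → ∣ N K S ∣ ≤ ∣ S ∣
    → HallCondition (R ─ S) (K ─ N K S)
  hall-complement {R} {K} {S} hallR S⊆R tight T T⊆R─S =
    +-cancelʳ-≤ (∣ S ∣) (∣ T ∣) (∣ N (K ─ N K S) T ∣) (begin
      ∣ T ∣ + ∣ S ∣                    ≡⟨ ∣∣-∪-disjoint {S = T} (proj₂ ∘ ∈─⁻ R S ∘ T⊆R─S) ⟨
      ∣ T ∪ S ∣                        ≤⟨ hallR (T ∪ S) T∪S⊆R ⟩
      ∣ N K (T ∪ S) ∣                  ≤⟨ ∣∣-⊆∪ {S = N K (T ∪ S)} (N-split K S T) ⟩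
      ∣ N (K ─ N K S) T ∣ + ∣ N K S ∣  ≤⟨ +-monoʳ-≤ (∣ N (K ─ N K S) T ∣) tight ⟩
      ∣ N (K ─ N K S) T ∣ + ∣ S ∣      ∎)
    where
    open ≤-Reasoning
    T∪S⊆R : T ∪ S ⊆ R
    T∪S⊆R i∈T∪S with ∈∪⁻ T S i∈T∪S
    ... | inj₁ i∈T = proj₁ (∈─⁻ R S (T⊆R─S i∈T))
    ... | inj₂ i∈S = S⊆R i∈S

  Tight : FinSet n → FinSet n → FinSet n → Set
  Tight R K S = S ⊆ R × (∃ λ x → x ∈ S) × (∃ λ y → y ∈ R × y ∉ S) × ∣ N K S ∣ ≤ ∣ S ∣

  tight? : ∀ R K S → Dec (Tight R K S)
  tight? R K S =
    map′ (λ h {i} → h i) (λ h i → h) (all? λ i → T? (S i) →-dec T? (R i))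
    ×-dec any? (λ x → T? (S x))
    ×-dec any? (λ y → T? (R y) ×-dec ¬? (T? (S y)))
    ×-dec (∣ N K S ∣ ≤? ∣ S ∣)

  tight-cong : ∀ {R K S S′} → (∀ i → S i ≡ S′ i) → Tight R K S → Tight R K S′
  tight-cong {K = K} {S} {S′} S≗S′ (S⊆R , (x , x∈S) , (y , y∈R , y∉S) , few) =
      (λ {i} i∈S′ → S⊆R (subst T (sym (S≗S′ i)) i∈S′))
    , (x , subst T (S≗S′ x) x∈S)
    , (y , y∈R , y∉S ∘ subst T (sym (S≗S′ y)))
    , subst₂ _≤_ (∣∣-cong (N-cong K S≗S′)) (∣∣-cong S≗S′) few

  tight-search : ∀ R K → (∃ λ S → Tight R K S) ⊎ (∀ S → ¬ Tight R K S)
  tight-search R K with anySubset? (λ v → tight? R K (lookup v))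
  ... | yes (v , tight) = inj₁ (lookup v , tight)
  ... | no  none        = inj₂ λ S tight →
        none (tabulate S , tight-cong (λ i → sym (lookup∘tabulate S i)) tight)

  -- Every member of R has a neighbour in K (Hall's condition for ⁅ r ⁆).
  neighbour : ∀ {R K r} → HallCondition R K → r ∈ R → ∃ λ c → c ∈ K × c ∈ D r
  neighbour {R} {K} {r} hallR r∈R =
    let c , c∈N = ∣∣-witness {S = N K ⁅ r ⁆} (subst (_≤ ∣ N K ⁅ r ⁆ ∣) (∣⁅⁆∣ r) (hallR ⁅ r ⁆ ⁅r⁆⊆R))
        c∈K , i , i∈⁅r⁆ , c∈Di = N-elim {K} {⁅ r ⁆} c∈N
    in c , c∈K , subst (λ i → c ∈ D i) (sym (∈⁅⁆⁻ i∈⁅r⁆)) c∈Di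
    where
    ⁅r⁆⊆R : ⁅ r ⁆ ⊆ R
    ⁅r⁆⊆R i∈⁅r⁆ = subst (_∈ R) (∈⁅⁆⁻ i∈⁅r⁆) r∈R

  N-shrink : ∀ K X T → N K T ⊆ N (K ─ X) T ∪ X
  N-shrink K X T {j} j∈N with T? (X j)
  ... | yes j∈X = ∈∪⁺ʳ (N (K ─ X) T) {X} j∈X
  ... | no  j∉X with N-elim {K} {T} j∈N
  ...   | j∈K , i , i∈T , j∈Di =
          ∈∪⁺ˡ {S = N (K ─ X) T} X (N-intro {K ─ X} {T} i∈T j∈Di (∈─⁺ {S = K} {X} j∈K j∉X))

  -- Without tight sets every nonempty T ⊆ R ─ ⁅ r ⁆ has a surplus neighbour, so one
  -- right vertex c may be removed while keeping Hall's condition.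
  hall-surplus : ∀ {R K r} → HallCondition R K → (∀ S → ¬ Tight R K S) → r ∈ R
    → ∀ c → HallCondition (R ─ ⁅ r ⁆) (K ─ ⁅ c ⁆)
  hall-surplus {R} {K} {r} hallR no-tight r∈R c T T⊆R─r with ∣∣-empty-or-witness T
  ... | inj₁ ∣T∣≡0     = subst (_≤ ∣ N (K ─ ⁅ c ⁆) T ∣) (sym ∣T∣≡0) z≤n
  ... | inj₂ (x , x∈T) = +-cancelʳ-≤ 1 (∣ T ∣) (∣ N (K ─ ⁅ c ⁆) T ∣) (begin
      ∣ T ∣ + 1                        ≡⟨ +-comm (∣ T ∣) 1 ⟩
      suc ∣ T ∣                        ≤⟨ surplus ⟩
      ∣ N K T ∣                        ≤⟨ ∣∣-⊆∪ {S = N K T} (N-shrink K ⁅ c ⁆ T) ⟩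
      ∣ N (K ─ ⁅ c ⁆) T ∣ + ∣ ⁅ c ⁆ ∣  ≡⟨ cong (∣ N (K ─ ⁅ c ⁆) T ∣ +_) (∣⁅⁆∣ c) ⟩
      ∣ N (K ─ ⁅ c ⁆) T ∣ + 1          ∎)
    where
    open ≤-Reasoning
    T⊆R : T ⊆ R
    T⊆R = proj₁ ∘ ∈─⁻ R ⁅ r ⁆ ∘ T⊆R─r
    r∉T : r ∉ T
    r∉T r∈T = proj₂ (∈─⁻ R ⁅ r ⁆ (T⊆R─r r∈T)) (∈⁅⁆⁺ {x = r} refl)
    surplus : ∣ T ∣ < ∣ N K T ∣
    surplus = ≰⇒> λ few → no-tight T (T⊆R , (x , x∈T) , (r , r∈R , r∉T) , few)

  tight-glue : ∀ {R K S f g} → Matching S K f → Matching (R ─ S) (K ─ N K S) g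
    → Matching R K (choose S f g)
  tight-glue {R} {K} {S} {f} {g} mf mg =
    glue mf (matching-weaken (proj₁ ∘ ∈─⁻ K (N K S)) mg)
      (apart-by {S = S} {R ─ S} {N K S} {f} {g}
        (λ i∈S → N-intro {K} {S} i∈S (along mf i∈S) (into mf i∈S))
        (proj₂ ∘ ∈─⁻ K (N K S) ∘ into mg))

  surplus-glue : ∀ {R K r c g} → c ∈ K → c ∈ D r → Matching (R ─ ⁅ r ⁆) (K ─ ⁅ c ⁆) g
    → Matching R K (choose ⁅ r ⁆ (λ _ → c) g)
  surplus-glue {R} {K} {r} {c} {g} c∈K c∈Dr mg =
    glue (singleton-matching c∈K c∈Dr) (matching-weaken (proj₁ ∘ ∈─⁻ K ⁅ c ⁆) mg)
      (apart-by {S = ⁅ r ⁆} {R ─ ⁅ r ⁆} {⁅ c ⁆} {λ _ → c} {g}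
        (λ _ → ∈⁅⁆⁺ {x = c} refl)
        (proj₂ ∘ ∈─⁻ K ⁅ c ⁆ ∘ into mg))

  hall : ∀ R K → HallCondition R K → ∃ λ f → Matching R K f
  hall R₀ = go R₀ (<-wellFounded ∣ R₀ ∣)
    where
    go : ∀ R → Acc _<_ ∣ R ∣ → ∀ K → HallCondition R K → ∃ λ f → Matching R K f
    go R (acc smaller) K hallR with ∣∣-empty-or-witness R
    ... | inj₁ ∣R∣≡0 = id , empty-matching (λ i∈R → <-irrefl (sym ∣R∣≡0) (∣∣-pos {S = R} i∈R))
    ... | inj₂ (r , r∈R) with tight-search R K
    ...   | inj₁ (S , S⊆R , (x , x∈S) , (y , y∈R , y∉S) , few) =
      let f , mf = go S (smaller (∣∣-strict {S = S} {R} S⊆R y∈R y∉S))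
                      K (restrict hallR S⊆R)
          g , mg = go (R ─ S) (smaller (∣─∣< {R = R} {S} (S⊆R x∈S) x∈S))
                      (K ─ N K S) (hall-complement hallR S⊆R few)
      in choose S f g , tight-glue mf mg
    ...   | inj₂ no-tight =
      let c , c∈K , c∈Dr = neighbour hallR r∈R
          g , mg = go (R ─ ⁅ r ⁆) (smaller (∣─∣< {R = R} {⁅ r ⁆} r∈R (∈⁅⁆⁺ {x = r} refl)))
                      (K ─ ⁅ c ⁆) (hall-surplus hallR no-tight r∈R c)
      in choose ⁅ r ⁆ (λ _ → c) g , surplus-glue c∈K c∈Dr mg

-- An injective self-map of Fin n is onto (a miss would give an injection into Fin (n - 1)).
injective⇒surjective : ∀ (f : Fin n → Fin n) → (∀ {i i′} → f i ≡ f i′ → i ≡ i′)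
  → ∀ j → ∃ λ i → f i ≡ j
injective⇒surjective {suc n} f f-inj j with any? (λ i → f i ≟ j)
... | yes hit  = hit
... | no  miss = ⊥-elim (1+n≰n (injective⇒≤ squeeze-injective))
  where
  j≢f : ∀ i → j ≢ f i
  j≢f i j≡fi = miss (i , sym j≡fi)
  squeeze : Fin (suc n) → Fin n
  squeeze i = punchOut (j≢f i)
  squeeze-injective : ∀ {i i′} → squeeze i ≡ squeeze i′ → i ≡ i′
  squeeze-injective {i} {i′} = f-inj ∘ punchOut-injective (j≢f i) (j≢f i′)

injective⇒permutation : ∀ (f : Fin n → Fin n) → (∀ {i i′} → f i ≡ f i′ → i ≡ i′)
  → Σ (Permutation′ n) λ σ → ∀ i → σ ⟨$⟩ʳ i ≡ f i
injective⇒permutation {n} f f-inj =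
  permutation f f⁻¹ (proj₂ ∘ onto) (λ i → f-inj (proj₂ (onto (f i)))) , λ _ → refl
  where
  onto : ∀ j → ∃ λ i → f i ≡ j
  onto = injective⇒surjective f f-inj
  f⁻¹ : Fin n → Fin n
  f⁻¹ = proj₁ ∘ onto

-- 0/1 matrices, read as bipartite graphs between rows and columns.
BoolMatrix : ℕ → Set
BoolMatrix n = Fin n → FinSet n

column : BoolMatrix n → Fin n → FinSet n
column D j i = D i j

Regular : ℕ → BoolMatrix n → Set
Regular d D = (∀ i → ∣ D i ∣ ≡ d) × (∀ j → ∣ column D j ∣ ≡ d)

⟦_⟧ : Permutation′ n → BoolMatrix n
⟦ σ ⟧ i = ⁅ σ ⟨$⟩ʳ i ⁆

⟦⟧-column : ∀ (σ : Permutation′ n) j i → column ⟦ σ ⟧ j i ≡ ⁅ σ ⟨$⟩ˡ j ⁆ i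
⟦⟧-column σ j i = does-⇔ (mk⇔ to from) (σ ⟨$⟩ʳ i ≟ j) (σ ⟨$⟩ˡ j ≟ i)
  where
  to : σ ⟨$⟩ʳ i ≡ j → σ ⟨$⟩ˡ j ≡ i
  to σi≡j = trans (cong (σ ⟨$⟩ˡ_) (sym σi≡j)) (inverseˡ σ)
  from : σ ⟨$⟩ˡ j ≡ i → σ ⟨$⟩ʳ i ≡ j
  from σ⁻¹j≡i = trans (cong (σ ⟨$⟩ʳ_) (sym σ⁻¹j≡i)) (inverseʳ σ)

∣∣-∧ : ∀ b (S : FinSet n) → ∑[ j < n ] 𝟙 (b ∧ S j) ≡ 𝟙 b * ∣ S ∣
∣∣-∧ {n} true  S = sym (+-identityʳ ∣ S ∣)
∣∣-∧ {n} false S = ∑-zero n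

-- A (d+1)-regular graph satisfies Hall's condition: the edges leaving S number
-- ∣ S ∣ (d+1) and all end in N S, which receives only ∣ N S ∣ (d+1) edges.
regular⇒hall : ∀ d (D : BoolMatrix n) → Regular (suc d) D
  → Hall.HallCondition D (λ _ → true) (λ _ → true)
regular⇒hall {n} d D (rows , cols) S _ = *-cancelʳ-≤ ∣ S ∣ ∣ NS ∣ (suc d) (begin
  ∣ S ∣ * suc d                          ≡⟨ *-distribʳ-sum (suc d) (𝟙 ∘ S) ⟩
  ∑[ i < n ] (𝟙 (S i) * suc d)           ≡⟨ sum-cong-≗ edges-from ⟨
  ∑[ i < n ] ∑[ j < n ] 𝟙 (S i ∧ D i j)  ≤⟨ ∑-mono (λ i → ∑-mono (edge-into-NS i)) ⟩
  ∑[ i < n ] ∑[ j < n ] 𝟙 (NS j ∧ D i j) ≡⟨ ∑-comm (λ i j → 𝟙 (NS j ∧ D i j)) ⟩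
  ∑[ j < n ] ∑[ i < n ] 𝟙 (NS j ∧ D i j) ≡⟨ sum-cong-≗ edges-into ⟩
  ∑[ j < n ] (𝟙 (NS j) * suc d)          ≡⟨ *-distribʳ-sum (suc d) (𝟙 ∘ NS) ⟨
  ∣ NS ∣ * suc d                         ∎)
  where
  open ≤-Reasoning
  open Hall D using (N; N-intro)
  NS : FinSet n
  NS = N (λ _ → true) S
  edges-from : ∀ i → ∑[ j < n ] 𝟙 (S i ∧ D i j) ≡ 𝟙 (S i) * suc d
  edges-from i = trans (∣∣-∧ (S i) (D i)) (cong (𝟙 (S i) *_) (rows i))
  edges-into : ∀ j → ∑[ i < n ] 𝟙 (NS j ∧ D i j) ≡ 𝟙 (NS j) * suc d
  edges-into j = trans (∣∣-∧ (NS j) (column D j)) (cong (𝟙 (NS j) *_) (cols j))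
  edge-into-NS : ∀ i j → 𝟙 (S i ∧ D i j) ≤ 𝟙 (NS j ∧ D i j)
  edge-into-NS i j = 𝟙-mono (S i ∧ D i j) (NS j ∧ D i j) λ i∈S∧j∈Di →
    let i∈S , j∈Di = T-∧⁻ (S i) i∈S∧j∈Di
    in T-∧⁺ (N-intro {λ _ → true} {S} i∈S j∈Di _) j∈Di

perfect-matching : ∀ d (D : BoolMatrix n) → Regular (suc d) D
  → Σ (Permutation′ n) λ σ → ∀ i → σ ⟨$⟩ʳ i ∈ D i
perfect-matching d D regular =
  let f , matching = hall (λ _ → true) (λ _ → true) (regular⇒hall d D regular)
      σ , σ≗f = injective⇒permutation f (injective matching _ _)
  in σ , λ i → subst (_∈ D i) (sym (σ≗f i)) (along matching _)
  where
  open Hall D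
  open Matching

remove-permutation : ∀ d (D : BoolMatrix n) (σ : Permutation′ n) → Regular (suc d) D
  → (∀ i → σ ⟨$⟩ʳ i ∈ D i) → Regular d (λ i → D i ─ ⟦ σ ⟧ i)
remove-permutation d D σ (rows , cols) σ⊆D = rows′ , cols′
  where
  rows′ : ∀ i → ∣ D i ─ ⟦ σ ⟧ i ∣ ≡ d
  rows′ i = suc-injective (trans (sym (∣∣-remove {S = D i} (σ⊆D i))) (rows i))
  cols′ : ∀ j → ∣ column (λ i → D i ─ ⟦ σ ⟧ i) j ∣ ≡ d
  cols′ j = suc-injective (begin
    suc ∣ column (λ i → D i ─ ⟦ σ ⟧ i) j ∣
      ≡⟨ cong suc (∣∣-cong (λ i → cong (λ b → D i j ∧ not b) (⟦⟧-column σ j i))) ⟩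
    suc ∣ column D j ─ ⁅ σ ⟨$⟩ˡ j ⁆ ∣
      ≡⟨ ∣∣-remove {S = column D j} (subst (_∈ D (σ ⟨$⟩ˡ j)) (inverseʳ σ) (σ⊆D _)) ⟨
    ∣ column D j ∣                         ≡⟨ cols j ⟩
    suc d                                  ∎)
    where open ≡-Reasoning

decompose : ∀ d (D : BoolMatrix n) → Regular d D
  → Σ (Fin d → Permutation′ n) λ σ → ∀ i j → ∑[ t < d ] 𝟙 (⟦ σ t ⟧ i j) ≡ 𝟙 (D i j)
decompose zero D (rows , _) =
  (λ ()) , λ i j → sym (n≤0⇒n≡0 (subst (𝟙 (D i j) ≤_) (rows i) (𝟙≤∣∣ (D i) j)))
decompose (suc d) D regular =
  let σ₀ , σ₀⊆D = perfect-matching d D regular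
      σ  , sums = decompose d (λ i → D i ─ ⟦ σ₀ ⟧ i) (remove-permutation d D σ₀ regular σ₀⊆D)
  in (λ { zero → σ₀ ; (suc t) → σ t })
   , λ i j → trans (cong (𝟙 (⟦ σ₀ ⟧ i j) +_) (sums i j))
                   (𝟙-split (⟦ σ₀ ⟧ i j) (D i j) (λ j∈σ₀i → subst (_∈ D i) (∈⁅⁆⁻ j∈σ₀i) (σ₀⊆D i)))

mark : Bool → Sign
mark true  = pos
mark false = zer

nonzeros-++ : ∀ xs ys → nonzeros (xs ++ ys) ≡ nonzeros xs ++ nonzeros ys
nonzeros-++ []         ys = refl
nonzeros-++ (zer ∷ xs) ys = nonzeros-++ xs ys
nonzeros-++ (pos ∷ xs) ys = cong (pos ∷_) (nonzeros-++ xs ys)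
nonzeros-++ (neg ∷ xs) ys = cong (neg ∷_) (nonzeros-++ xs ys)

nonzeros-mark : ∀ (S : FinSet n) → nonzeros (vec (mark ∘ S)) ≡ replicate ∣ S ∣ pos
nonzeros-mark {zero}  S = refl
nonzeros-mark {suc n} S with S zero
... | true  = cong (pos ∷_) (nonzeros-mark (S ∘ suc))
... | false = nonzeros-mark (S ∘ suc)

even : ℕ → Bool
even zero          = true
even (suc zero)    = false
even (suc (suc n)) = even n

-- A (1,*)-alternating vector with an even number of nonzeros ends (if at all) with −1,
-- so it needs a final +1 to become alternating sign; with an odd number it already is.
needsOne : List Sign → Bool
needsOne v = even (length (nonzeros v))

complete : ∀ {xs} → AltFromPos xs → PosAltPos (xs ++ replicate (𝟙 (even (length xs))) pos)
complete ap-nil                = single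
complete (ap-cons an-nil)      = single
complete (ap-cons (an-cons p)) = step (complete p)

complete-line : ∀ {xs} (S : FinSet n) → OneStarAlt xs → ∣ S ∣ ≡ 𝟙 (needsOne xs)
  → AltSign (xs ++ vec (mark ∘ S))
complete-line {xs = xs} S oneStar ∣S∣≡ = subst PosAltPos (sym nonzeros≡) (complete oneStar)
  where
  nonzeros≡ : nonzeros (xs ++ vec (mark ∘ S)) ≡ nonzeros xs ++ replicate (𝟙 (needsOne xs)) pos
  nonzeros≡ = trans (nonzeros-++ xs (vec (mark ∘ S)))
                    (cong (nonzeros xs ++_) (trans (nonzeros-mark S) (cong (λ c → replicate c pos) ∣S∣≡)))

isPos isNeg : Sign → Bool
isPos pos = true
isPos _   = false
isNeg neg = true
isNeg _   = false

tally : (Sign → Bool) → List Sign → ℕ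
tally p []       = 0
tally p (x ∷ xs) = 𝟙 (p x) + tally p xs

tally-nonzeros : ∀ p → p zer ≡ false → (f : Fin n → Sign)
  → tally p (nonzeros (vec f)) ≡ ∣ p ∘ f ∣
tally-nonzeros p p0 f = trans (over-nonzeros (vec f)) (over-tabulate f)
  where
  over-nonzeros : ∀ xs → tally p (nonzeros xs) ≡ tally p xs
  over-nonzeros []         = refl
  over-nonzeros (zer ∷ xs) = trans (over-nonzeros xs) (cong (λ b → 𝟙 b + tally p xs) (sym p0))
  over-nonzeros (pos ∷ xs) = cong (𝟙 (p pos) +_) (over-nonzeros xs)
  over-nonzeros (neg ∷ xs) = cong (𝟙 (p neg) +_) (over-nonzeros xs)
  over-tabulate : ∀ {n} (f : Fin n → Sign) → tally p (vec f) ≡ ∣ p ∘ f ∣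
  over-tabulate {zero}  f = refl
  over-tabulate {suc n} f = cong (𝟙 (p (f zero)) +_) (over-tabulate (f ∘ suc))

posAltPos-balance : ∀ {ys} → PosAltPos ys → tally isPos ys ≡ tally isNeg ys + 1
posAltPos-balance single   = refl
posAltPos-balance (step p) = cong suc (posAltPos-balance p)

altFromPos-balance : ∀ {ys} → AltFromPos ys
  → tally isPos ys ≡ tally isNeg ys + 𝟙 (not (even (length ys)))
altFromPos-balance ap-nil                = refl
altFromPos-balance (ap-cons an-nil)      = refl
altFromPos-balance (ap-cons (an-cons p)) = cong suc (altFromPos-balance p)

alt-balance : ∀ (f : Fin n → Sign) → AltSign (vec f) → ∣ isPos ∘ f ∣ ≡ ∣ isNeg ∘ f ∣ + 1
alt-balance f alt = begin
  ∣ isPos ∘ f ∣                      ≡⟨ tally-nonzeros isPos refl f ⟨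
  tally isPos (nonzeros (vec f))     ≡⟨ posAltPos-balance alt ⟩
  tally isNeg (nonzeros (vec f)) + 1 ≡⟨ cong (_+ 1) (tally-nonzeros isNeg refl f) ⟩
  ∣ isNeg ∘ f ∣ + 1                  ∎
  where open ≡-Reasoning

oneStar-balance : ∀ (f : Fin n → Sign) → OneStarAlt (vec f)
  → ∣ isPos ∘ f ∣ ≡ ∣ isNeg ∘ f ∣ + 𝟙 (not (needsOne (vec f)))
oneStar-balance f oneStar = begin
  ∣ isPos ∘ f ∣                   ≡⟨ tally-nonzeros isPos refl f ⟨
  tally isPos (nonzeros (vec f))  ≡⟨ altFromPos-balance oneStar ⟩
  tally isNeg (nonzeros (vec f)) + 𝟙 (not (needsOne (vec f)))
                                  ≡⟨ cong (_+ 𝟙 (not (needsOne (vec f)))) (tally-nonzeros isNeg refl f) ⟩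
  ∣ isNeg ∘ f ∣ + 𝟙 (not (needsOne (vec f))) ∎
  where open ≡-Reasoning

-- In a k × n array of signs whose rows are alternating sign and whose columns are
-- (1,*)-alternating, exactly n − k columns need a final +1: the rows carry k more
-- +1's than −1's in total, and a column carries one extra +1 iff it needs none.
needsOne-count : ∀ {k} (F : Fin k → Fin n → Sign)
  → (∀ s → AltSign (vec (F s))) → (∀ j → OneStarAlt (vec (λ s → F s j)))
  → k + ∣ (λ j → needsOne (vec (λ s → F s j))) ∣ ≡ n
needsOne-count {n} {k} F rows columns = begin
  k + ∣ needs ∣               ≡⟨ cong (_+ ∣ needs ∣) odd-count ⟨
  ∣ not ∘ needs ∣ + ∣ needs ∣ ≡⟨ +-comm (∣ not ∘ needs ∣) (∣ needs ∣) ⟩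
  ∣ needs ∣ + ∣ not ∘ needs ∣ ≡⟨ ∣∣-complement needs ⟩
  n                           ∎
  where
  open ≡-Reasoning
  col : Fin n → Fin k → Sign
  col j s = F s j
  needs : FinSet n
  needs j = needsOne (vec (col j))
  negatives : ℕ
  negatives = ∑[ j < n ] ∣ isNeg ∘ col j ∣
  odd-count : ∣ not ∘ needs ∣ ≡ k
  odd-count = +-cancelˡ-≡ negatives (∣ not ∘ needs ∣) k (begin
    negatives + ∣ not ∘ needs ∣
      ≡⟨ ∑-distrib-+ (λ j → ∣ isNeg ∘ col j ∣) (𝟙 ∘ not ∘ needs) ⟨
    ∑[ j < n ] (∣ isNeg ∘ col j ∣ + 𝟙 (not (needs j)))
      ≡⟨ sum-cong-≗ (λ j → oneStar-balance (col j) (columns j)) ⟨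
    ∑[ j < n ] ∣ isPos ∘ col j ∣
      ≡⟨ ∑-comm (λ s j → 𝟙 (isPos (F s j))) ⟨
    ∑[ s < k ] ∣ isPos ∘ F s ∣
      ≡⟨ sum-cong-≗ (λ s → alt-balance (F s) (rows s)) ⟩
    ∑[ s < k ] (∣ isNeg ∘ F s ∣ + 1)
      ≡⟨ ∑-distrib-+ (λ s → ∣ isNeg ∘ F s ∣) (λ _ → 1) ⟩
    ∑[ s < k ] ∣ isNeg ∘ F s ∣ + ∑[ s < k ] 1
      ≡⟨ cong₂ _+_ (∑-comm (λ s j → 𝟙 (isNeg (F s j)))) (∑-one k) ⟩
    negatives + k
      ∎)

permPlane : Permutation′ n → Matrix n
permPlane σ i j = mark (⟦ σ ⟧ i j)

single-one : ∀ (S : FinSet n) → ∣ S ∣ ≡ 1 → AltSign (vec (mark ∘ S))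
single-one S ∣S∣≡1 =
  subst PosAltPos (sym (trans (nonzeros-mark S) (cong (λ c → replicate c pos) ∣S∣≡1))) single

permPlane-isASM : ∀ (σ : Permutation′ n) → IsASM (permPlane σ)
permPlane-isASM σ =
    (λ i → single-one (⟦ σ ⟧ i) (∣⁅⁆∣ (σ ⟨$⟩ʳ i)))
  , (λ j → single-one (column ⟦ σ ⟧ j) (trans (∣∣-cong (⟦⟧-column σ j)) (∣⁅⁆∣ (σ ⟨$⟩ˡ j))))

permPlane-isPerm : ∀ (σ : Permutation′ n) → IsPermMatrix (permPlane σ)
permPlane-isPerm σ = σ , λ i j →
    (λ σi≡j → cong mark (dec-true  (σ ⟨$⟩ʳ i ≟ j) σi≡j))
  , (λ σi≢j → cong mark (dec-false (σ ⟨$⟩ʳ i ≟ j) σi≢j))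

isPerm-cong : ∀ {M M′ : Matrix n} → (∀ i j → M i j ≡ M′ i j) → IsPermMatrix M′ → IsPermMatrix M
isPerm-cong M≗M′ (σ , entries) = σ , λ i j →
  (trans (M≗M′ i j) ∘ proj₁ (entries i j)) , (trans (M≗M′ i j) ∘ proj₂ (entries i j))

stack : ∀ {k m} → (Fin k → Matrix (k + m)) → (Fin m → Matrix (k + m)) → Hyper (k + m)
stack {k} A B i j s = [ A , B ]′ (splitAt k s) i j

tabulate-splitAt : ∀ k {m} {X : Set} (h : Fin k ⊎ Fin m → X)
  → List.tabulate (h ∘ splitAt k) ≡ List.tabulate (h ∘ inj₁) ++ List.tabulate (h ∘ inj₂)
tabulate-splitAt zero    h = refl
tabulate-splitAt (suc k) h = cong (h (inj₁ zero) ∷_) (tabulate-splitAt k (h ∘ map₁ suc))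

stack-vertical : ∀ {k m} (A : Fin k → Matrix (k + m)) B i j
  → vec (stack A B i j) ≡ vec (λ s → A s i j) ++ vec (λ t → B t i j)
stack-vertical {k} A B i j = tabulate-splitAt k (λ x → [ A , B ]′ x i j)

stack-isASM : ∀ {k m} {A : Fin k → Matrix (k + m)} {B}
  → (∀ s → IsASM (A s)) → (∀ t → IsASM (B t)) → ∀ s → IsASM (λ i j → stack A B i j s)
stack-isASM {k} {A = A} {B} A-asm B-asm s =
  [_,_] {C = λ x → IsASM ([ A , B ]′ x)} A-asm B-asm (splitAt k s)

stack-first : ∀ {k m} (A : Fin k → Matrix (k + m)) B .(k≤k+m : k ≤ k + m) s i j
  → stack A B i j (inject≤ s k≤k+m) ≡ A s i j
stack-first {k} {m} A B k≤k+m s i j =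
  cong (λ x → [ A , B ]′ x i j) (trans (cong (splitAt k) inject≤≡↑ˡ) (splitAt-↑ˡ k s m))
  where
  inject≤≡↑ˡ : inject≤ s k≤k+m ≡ s ↑ˡ m
  inject≤≡↑ˡ = toℕ-injective (trans (toℕ-inject≤ s k≤k+m) (sym (toℕ-↑ˡ s m)))

stack-later : ∀ {k m} (A : Fin k → Matrix (k + m)) B s .(k≤s : k ≤ toℕ s) i j
  → stack A B i j s ≡ B (reduce≥ s k≤s) i j
stack-later {k} A B s k≤s i j = cong (λ x → [ A , B ]′ x i j) (splitAt-≥ k s k≤s)

stack-isASHM : ∀ {k m} {A : Fin k → Matrix (k + m)} {B}
  → (∀ s → IsASM (A s)) → (∀ t → IsASM (B t))
  → (∀ i j → AltSign (vec (stack A B i j))) → IsASHM (stack A B)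
stack-isASHM A-asm B-asm vertical =
    (λ j s → proj₂ (stack-isASM A-asm B-asm s) j)
  , (λ i s → proj₁ (stack-isASM A-asm B-asm s) i)
  , vertical

needing : ∀ {k} → (Fin k → Matrix n) → BoolMatrix n
needing A i j = needsOne (vec (λ s → A s i j))

-- By the parity count, applied to each row and each column of the stack, it is
-- m-regular when there are n = k + m planes to fill.
needing-regular : ∀ {k m} (A : Fin k → Matrix (k + m)) → (∀ s → IsASM (A s))
  → (∀ i j → OneStarAlt (vec (λ s → A s i j))) → Regular m (needing A)
needing-regular {k} A asm oneStar =
    (λ i → +-cancelˡ-≡ k _ _ (needsOne-count (λ s j → A s i j) (λ s → proj₁ (asm s) i) (oneStar i)))
  , (λ j → +-cancelˡ-≡ k _ _
             (needsOne-count (λ s i → A s i j) (λ s → proj₂ (asm s) j) (λ i → oneStar i j)))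

-- Theorem 4.3.  Write n = k + m and decompose `needing A` into permutation matrices
-- σ₁, …, σ_m.  Stacked below A₁, …, A_k they add exactly the missing +1 to every
-- vertical line, and the added planes are permutation matrices.
theorem4p3 : (n k : ℕ) → (k<n : k < n) → (A : Fin k → Matrix n)
    → (∀ s → IsASM (A s))
    → (∀ i j → OneStarAlt (vec (λ s → A s i j)))
    → Σ (Hyper n) λ H →
    IsASHM H
    × (∀ (s : Fin k) i j → H i j (inject≤ s (<⇒≤ k<n)) ≡ A s i j)
    × (∀ (s : Fin n) → k ≤ toℕ s → IsPermMatrix (λ i j → H i j s))
theorem4p3 n k k<n A asm oneStar with m≤n⇒∃[o]m+o≡n (<⇒≤ k<n)
... | m , refl =
    stack A B
  , stack-isASHM asm (permPlane-isASM ∘ σ) completed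
  , stack-first A B (<⇒≤ k<n)
  , λ s k≤s → isPerm-cong (stack-later A B s k≤s) (permPlane-isPerm (σ (reduce≥ s k≤s)))
  where
  decomposition : Σ (Fin m → Permutation′ (k + m)) λ σ
    → ∀ i j → ∑[ t < m ] 𝟙 (⟦ σ t ⟧ i j) ≡ 𝟙 (needing A i j)
  decomposition = decompose m (needing A) (needing-regular A asm oneStar)
  σ : Fin m → Permutation′ (k + m)
  σ = proj₁ decomposition
  B : Fin m → Matrix (k + m)
  B = permPlane ∘ σ
  completed : ∀ i j → AltSign (vec (stack A B i j))
  completed i j = subst AltSign (sym (stack-vertical A B i j))
    (complete-line {xs = vec (λ s → A s i j)} (λ t → ⟦ σ t ⟧ i j)
                   (oneStar i j) (proj₂ decomposition i j))
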